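{- Let $k\ge1$. There is a polynomial function $f(k)$ such that every signed graph $(G,\sigma)$ with $\psi(G,\sigma)=k$ has an induced signed subgraph $(G',\sigma)$ (i.e., $G'$ an induced subgraph of $G$ with the restriction of $\sigma$) with $\psi(G',\sigma)=k$ and $|E(G')|\le f(k)$.
   Context: A signed graph $(G,\sigma)$ is a finite simple graph $G$ with a signature $\sigma:E(G)\to\{ -,+\}$. Switching a set $S\subseteq V(G)$ changes the sign of every edge with exactly one end in $S$; two signed graphs on the same underlying graph are equivalent if one is obtained from the other by switching some set of vertices. For $k\ge1$ let $M_k=\{ -n,\dots,-1,+1,\dots,+n\}$ if $k=2n$, and $M_k=\{ -n,\dots,-1,\pm0,+1,\dots,+n\}$ if $k=2n+1$, where $\pm0$ is a single colour with $-(\pm0)=\pm0$. A $k$-colouring of $(G,\sigma)$ is a map $\phi:V(G)\to M_k$. Let $K_k^*$ be the signed multigraph with vertex set $\{i\ge 0: +i\in M_k\}$ (vertex $0$ standing for colour $\pm0$ when $k$ is odd), in which every two distinct vertices are joined by exactly one positive and one negative edge, and every vertex $i\neq0$ carries exactly one negative loop. Given a $k$-colouring $\phi$, the reduced signed graph $R(G,\sigma,\phi)$ is obtained by (1) switching every vertex with a negative colour $-i$ and recolouring it $+i$; (2) identifying, for each $i$, all vertices of colour $+i$ (resp. $\pm0$) into a single vertex $i$ (resp. $0$), edges inside a class becoming loops; (3) keeping at most one positive and at most one negative edge (or loop) between any two vertices (or at any vertex). The colouring $\phi$ is complete if $R(G,\sigma,\phi)$ is exactly $K_k^*$. The achromatic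 number $\psi(G,\sigma)$ is the largest $k\ge1$ such that some signed graph equivalent to $(G,\sigma)$ admits a complete $k$-colouring. -}

module Defs where

open import Data.Nat using (ℕ; zero; suc; _+_; _*_; _≤_; _<ᵇ_; _/_; _%_)
open import Data.Bool using (Bool; true; false; if_then_else_; _xor_)
open import Data.Maybe using (Maybe; just; nothing; is-just)
import Data.Maybe as Maybe
open import Data.Fin using (Fin; toℕ)
open import Data.List using (List; []; _∷_; allFin)
open import Data.Nat.ListAction using (sum)
import Data.List as List
open import Data.Product using (Σ; _×_; _,_; ∃; ∃-syntax; proj₁; proj₂)
open import Relation.Binary.PropositionalEquality using (_≡_; _≢_)
open import Relation.Nullary using (¬_)
open import Function.Definitions using (Injective)

data Sign : Set where
  pos neg : Sign

flip : Sign → Sign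
flip pos = neg
flip neg = pos

flipIf : Bool → Sign → Sign
flipIf true  s = flip s
flipIf false s = s

SEdges : ℕ → Set
SEdges n = Fin n → Fin n → Maybe Sign

IsSigned : ∀ {n} → SEdges n → Set
IsSigned {n} E = (∀ (u v : Fin n) → E u v ≡ E v u) × (∀ (u : Fin n) → E u u ≡ nothing)

switch : ∀ {n} → (Fin n → Bool) → SEdges n → SEdges n
switch S E u v = Maybe.map (flipIf (S u xor S v)) (E u v)

-- induced signed subgraph on the image of an injection ι
restrict : ∀ {m n} → (Fin m → Fin n) → SEdges n → SEdges m
restrict ι E u v = E (ι u) (ι v)

edgeCount : ∀ {n} → SEdges n → ℕ
edgeCount {n} E =
  sum (List.map (λ u → sum (List.map (λ v → ind u v) (allFin n))) (allFin n))
  where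
  ind : Fin n → Fin n → ℕ
  ind u v = if toℕ u <ᵇ toℕ v then (if is-just (E u v) then 1 else 0) else 0

-- Colours.  A colour is a pair (i , b): b ≡ true means the colour -i,
-- b ≡ false means +i (or ±0 when i ≡ 0).

Colour : Set
Colour = ℕ × Bool

-- i is a vertex of K_k^*  (i.e. +i ∈ M_k, with 0 standing for ±0)
InV : ℕ → ℕ → Set
InV k i = (1 ≤ i → i ≤ k / 2) × (i ≡ 0 → k % 2 ≡ 1)

-- (i , b) ∈ M_k ; ±0 is the single colour (0 , false)
InM : ℕ → Colour → Set
InM k (i , b) = InV k i × (i ≡ 0 → b ≡ false)

-- reduced signed graph data: step (1) is switching the negatively
-- coloured vertices; step (2)/(3) identify vertices by the index.
reduceSwitch : ∀ {n} → (Fin n → Colour) → SEdges n → SEdges n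
reduceSwitch φ E = switch (λ v → proj₂ (φ v)) E

idx : ∀ {n} → (Fin n → Colour) → Fin n → ℕ
idx φ v = proj₁ (φ v)

-- φ is a complete k-colouring: R(G,σ,φ) is exactly K_k^*.
record Complete {n} (k : ℕ) (E : SEdges n) (φ : Fin n → Colour) : Set where
  field
    valid   : ∀ v → InM k (φ v)
    onto    : ∀ i → InV k i → ∃[ v ] idx φ v ≡ i
    between : ∀ i j → InV k i → InV k j → i ≢ j → ∀ (s : Sign) →
              ∃[ u ] ∃[ v ] (idx φ u ≡ i × idx φ v ≡ j × reduceSwitch φ E u v ≡ just s)
    negLoop : ∀ i → InV k i → i ≢ 0 →
              ∃[ u ] ∃[ v ] (idx φ u ≡ i × idx φ v ≡ i × reduceSwitch φ E u v ≡ just neg)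
    noOther : ∀ u v (s : Sign) → idx φ u ≡ idx φ v → reduceSwitch φ E u v ≡ just s →
              (s ≡ neg × idx φ u ≢ 0)

Achievable : ∀ {n} → SEdges n → ℕ → Set
Achievable {n} E k = ∃[ S ] ∃[ φ ] Complete k (switch {n} S E) φ

Psi≡ : ∀ {n} → SEdges n → ℕ → Set
Psi≡ E k = 1 ≤ k × Achievable E k × (∀ k' → 1 ≤ k' → Achievable E k' → k' ≤ k)

-- Polynomials with natural coefficients (constant term first)

Poly : Set
Poly = List ℕ

eval : Poly → ℕ → ℕ
eval []       x = 0
eval (c ∷ cs) x = c + x * eval cs x

module Submission where

-- ψ does not increase on induced subgraphs: a complete colouring of an induced subgraph extends,
-- one vertex x at a time and possibly with more colours, to the whole graph.  If some nonzero
-- class receives no positive edge from x, x joins it; if it receives no negative edge, x is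
-- switched first and joins it.  Otherwise x sees both signs in every nonzero class; for k even
-- x becomes the new class ±0, and for k odd x joins ±0 if it has no edge there, while otherwise
-- ±0 and x merge into the new class +(k+1)/2, after switching the ends in ±0 of the positive
-- edges from x.
-- A complete k-colouring of G is certified by an occupant of every class and the two ends of an
-- edge of each sign between and within classes, at most (k+1)(4k+5) vertices.  The subgraph they
-- induce is still completely k-coloured, so by the above its ψ is exactly k, and it has at most
-- ((k+1)(4k+5))² edges.

open import Defs
open import Data.Nat using (ℕ; zero; suc; _+_; _*_; _≤_; _<_; _/_; _%_; z≤n; s≤s; _<ᵇ_)
open import Data.Nat.Properties
  using (≤-trans; ≤-refl; ≤-reflexive; ≤-pred; m≤n⇒m≤1+n; ≤∧≢⇒<; *-identityʳ; +-mono-≤; *-mono-≤;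
         anyUpTo?)
import Data.Nat.Properties as ℕ
open import Data.Nat.DivMod using (m/n≡1+[m∸n]/n; m/n≤m)
open import Data.Nat.ListAction using (sum)
open import Data.Bool using (Bool; true; false; _xor_; _∧_; if_then_else_)
open import Data.Bool.Properties using (xor-∧-commutativeRing; xor-comm; xor-identityʳ; ∧-zeroʳ; ∧-identityʳ)
open import Algebra.Bundles using (CommutativeRing; CommutativeMonoid)
open import Algebra.Properties.CommutativeSemigroup
  (CommutativeMonoid.commutativeSemigroup (CommutativeRing.+-commutativeMonoid xor-∧-commutativeRing))
  using (interchange)
open import Data.Maybe using (Maybe; just; nothing; is-just)
import Data.Maybe as Maybe
import Data.Maybe.Properties as Maybe
open import Data.Fin using (Fin; toℕ)
import Data.Fin as Fin
open import Data.Fin.Properties using (_≟_; any?)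
open import Data.List using (List; []; _∷_; allFin; length; _++_; concatMap; upTo; lookup; deduplicate)
import Data.List as List
open import Data.List.Properties using (length-++; length-upTo; length-tabulate; length-deduplicate)
open import Data.List.Membership.Propositional using (_∈_; lose)
open import Data.List.Membership.Propositional.Properties
  using (∈-allFin; ∈-++⁺ˡ; ∈-++⁺ʳ; ∈-concatMap⁺; ∈-upTo⁺; ∈-lookup; ∈-deduplicate⁺; ∈-deduplicate⁻)
open import Data.List.Relation.Unary.Unique.Propositional using (Unique)
open import Data.List.Relation.Unary.Unique.DecPropositional.Properties using (deduplicate-!)
open import Data.List.Relation.Unary.AllPairs using (_∷_)
import Data.List.Relation.Unary.All as All
open import Data.List.Relation.Unary.Any.Properties using (lookup-index)
open import Data.List.Relation.Unary.Any using (here; there)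
import Data.List.Relation.Unary.Any as Any
open import Data.Vec.Functional using (updateAt)
open import Data.Vec.Functional.Properties using (updateAt-updates; updateAt-minimal)
open import Data.Product using (Σ-syntax; _×_; _,_; ∃-syntax; proj₁; proj₂)
open import Data.Sum using (_⊎_; inj₁; inj₂)
open import Data.Unit using (⊤; tt)
open import Function using (const; _∘_)
open import Function.Definitions using (Injective)
open import Data.Nat.Solver using (module +-*-Solver)
open import Relation.Binary.PropositionalEquality
open import Relation.Nullary using (¬_; Dec; yes; no; does; contradiction; _×-dec_; _⊎-dec_; ¬?)
open import Relation.Nullary.Decidable using (dec-true; dec-false; decidable-stable)

flipIf-flipIf : ∀ a b s → flipIf a (flipIf b s) ≡ flipIf (b xor a) s
flipIf-flipIf false false s   = refl
flipIf-flipIf false true  s   = refl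
flipIf-flipIf true  false s   = refl
flipIf-flipIf true  true  pos = refl
flipIf-flipIf true  true  neg = refl

map-flipIf-flipIf : ∀ a b m → Maybe.map (flipIf a) (Maybe.map (flipIf b) m) ≡ Maybe.map (flipIf (b xor a)) m
map-flipIf-flipIf a b nothing  = refl
map-flipIf-flipIf a b (just s) = cong just (flipIf-flipIf a b s)

map-flipIf-false : ∀ m → Maybe.map (flipIf false) m ≡ m
map-flipIf-false nothing  = refl
map-flipIf-false (just s) = refl

isPos : Maybe Sign → Bool
isPos (just pos) = true
isPos _          = false

flipIf-isPos-≡just : ∀ m {s} → Maybe.map (flipIf (isPos m)) m ≡ just s → s ≡ neg
flipIf-isPos-≡just (just pos) refl = refl
flipIf-isPos-≡just (just neg) refl = refl

flipIf-isPos-≢nothing : ∀ m → m ≢ nothing → Maybe.map (flipIf (isPos m)) m ≡ just neg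
flipIf-isPos-≢nothing nothing    m≢nothing = contradiction refl m≢nothing
flipIf-isPos-≢nothing (just pos) _         = refl
flipIf-isPos-≢nothing (just neg) _         = refl

map-flip-≢ : ∀ m s → m ≢ just (flip s) → Maybe.map flip m ≢ just s
map-flip-≢ (just pos) neg m≢ refl = m≢ refl
map-flip-≢ (just neg) pos m≢ refl = m≢ refl

map-≡just : ∀ {f : Sign → Sign} m {s} → Maybe.map f m ≡ just s → ∃[ s′ ] m ≡ just s′
map-≡just (just s′) _ = s′ , refl

_≟ˢ_ : (s t : Sign) → Dec (s ≡ t)
pos ≟ˢ pos = yes refl
pos ≟ˢ neg = no λ ()
neg ≟ˢ pos = no λ ()
neg ≟ˢ neg = yes refl

_≟ᵐ_ : (m m′ : Maybe Sign) → Dec (m ≡ m′)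
_≟ᵐ_ = Maybe.≡-dec _≟ˢ_

module _ {n : ℕ} (E : SEdges n) where

  switch-switch : ∀ S F u v → switch F (switch S E) u v ≡ switch (λ w → S w xor F w) E u v
  switch-switch S F u v = begin
    Maybe.map (flipIf (F u xor F v)) (Maybe.map (flipIf (S u xor S v)) (E u v))
      ≡⟨ map-flipIf-flipIf (F u xor F v) (S u xor S v) (E u v) ⟩
    Maybe.map (flipIf ((S u xor S v) xor (F u xor F v))) (E u v)
      ≡⟨ cong (λ b → Maybe.map (flipIf b) (E u v)) (interchange (S u) (S v) (F u) (F v)) ⟩
    Maybe.map (flipIf ((S u xor F u) xor (S v xor F v))) (E u v) ∎
    where open ≡-Reasoning

  switch-cong : ∀ {S S′ u v} → S′ u ≡ S u → S′ v ≡ S v → switch S′ E u v ≡ switch S E u v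
  switch-cong eu ev = cong (λ b → Maybe.map (flipIf b) (E _ _)) (cong₂ _xor_ eu ev)

  switch-sym : (∀ u v → E u v ≡ E v u) → ∀ S u v → switch S E u v ≡ switch S E v u
  switch-sym E-sym S u v = cong₂ Maybe.map (cong flipIf (xor-comm (S u) (S v))) (E-sym u v)

  switch-loopless : (∀ u → E u u ≡ nothing) → ∀ S u → switch S E u u ≡ nothing
  switch-loopless E-loopless S u = cong (Maybe.map _) (E-loopless u)

suc-suc-/2 : ∀ k → suc (suc k) / 2 ≡ suc (k / 2)
suc-suc-/2 k = m/n≡1+[m∸n]/n {suc (suc k)} {2} (s≤s (s≤s z≤n))

data ParityStep (k : ℕ) : Set where
  even : k % 2 ≡ 0 → suc k % 2 ≡ 1 → suc k / 2 ≡ k / 2 → ParityStep k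
  odd  : k % 2 ≡ 1 → suc k % 2 ≡ 0 → suc k / 2 ≡ suc (k / 2) → ParityStep k

parityStep : ∀ k → ParityStep k
parityStep zero          = even refl refl refl
parityStep (suc zero)    = odd refl refl refl
parityStep (suc (suc k)) with parityStep k
... | even k%2 sk%2 half =
  even k%2 sk%2 (trans (suc-suc-/2 (suc k)) (trans (cong suc half) (sym (suc-suc-/2 k))))
... | odd  k%2 sk%2 half =
  odd  k%2 sk%2 (trans (suc-suc-/2 (suc k)) (cong suc (trans half (sym (suc-suc-/2 k)))))

InV-intro : ∀ {k i} → i ≤ k / 2 → i ≢ 0 → InV k i
InV-intro i≤ i≢0 = const i≤ , λ i≡0 → contradiction i≡0 i≢0

InV⇒< : ∀ {k i} → InV k i → i < suc (k / 2)
InV⇒< {i = zero}  _       = s≤s z≤n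
InV⇒< {i = suc _} (i≤ , _) = s≤s (i≤ (s≤s z≤n))

InV-zero : ∀ {k} → k % 2 ≡ 1 → InV k 0
InV-zero k%2≡1 = (λ ()) , const k%2≡1

InV-even⇒≢0 : ∀ {k i} → k % 2 ≡ 0 → InV k i → i ≢ 0
InV-even⇒≢0 k%2≡0 (_ , zero⇒odd) i≡0 with trans (sym k%2≡0) (zero⇒odd i≡0)
... | ()

InV-nonzero : ∀ {k k′ i} → k / 2 ≡ k′ / 2 → InV k i → i ≢ 0 → InV k′ i
InV-nonzero {i = zero}  _    _        i≢0 = contradiction refl i≢0
InV-nonzero {k′ = k′} {i = suc m} half (i≤ , _) _ =
  InV-intro {k′} {suc m} (subst (suc m ≤_) half (i≤ (s≤s z≤n))) λ ()

-- For odd k the class ±0 of K_k^* becomes the new class +(k+1)/2 of K_{k+1}^*.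
relabelZero : ℕ → ℕ → ℕ
relabelZero top zero    = top
relabelZero top (suc m) = suc m

relabelZero≢0 : ∀ top j → relabelZero (suc top) j ≢ 0
relabelZero≢0 top zero    ()
relabelZero≢0 top (suc j) ()

relabelZero-nonzero : ∀ top j → j ≢ 0 → relabelZero top j ≡ j
relabelZero-nonzero top zero    j≢0 = contradiction refl j≢0
relabelZero-nonzero top (suc j) _   = refl

module OddStep {k : ℕ} (half : suc k / 2 ≡ suc (k / 2)) where

  InV-top : InV (suc k) (suc (k / 2))
  InV-top = const (≤-reflexive (sym half)) , λ ()

  InV-relabelZero : ∀ {j} → InV k j → InV (suc k) (relabelZero (suc (k / 2)) j)
  InV-relabelZero {zero}  _        = InV-top
  InV-relabelZero {suc j} (j≤ , _) =
    InV-intro {suc k} {suc j} (subst (suc j ≤_) (sym half) (m≤n⇒m≤1+n (j≤ (s≤s z≤n)))) λ ()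

  InV-below-top : ∀ {i} → suc k % 2 ≡ 0 → InV (suc k) i → i ≢ suc (k / 2) → InV k i
  InV-below-top {zero}  sk%2≡0 Ii       _     = contradiction refl (InV-even⇒≢0 {suc k} sk%2≡0 Ii)
  InV-below-top {suc i} _      (i≤ , _) i≢top =
    InV-intro {k} {suc i} (≤-pred (≤∧≢⇒< (subst (suc i ≤_) half (i≤ (s≤s z≤n))) i≢top)) λ ()

  relabelZero-injective : ∀ {j j′} → InV k j → InV k j′ →
                          relabelZero (suc (k / 2)) j ≡ relabelZero (suc (k / 2)) j′ → j ≡ j′
  relabelZero-injective {zero}  {zero}   _        _         _ = refl
  relabelZero-injective {zero}  {suc j′} _        (j′≤ , _) e =
    contradiction (subst (_≤ k / 2) (sym e) (j′≤ (s≤s z≤n))) ℕ.1+n≰n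
  relabelZero-injective {suc j} {zero}   (j≤ , _) _         e =
    contradiction (subst (_≤ k / 2) e (j≤ (s≤s z≤n))) ℕ.1+n≰n
  relabelZero-injective {suc j} {suc j′} _        _         e = e

length-concatMap-≤ : ∀ {A B : Set} (f : A → List B) {b} → (∀ x → length (f x) ≤ b) →
                     ∀ xs → length (concatMap f xs) ≤ length xs * b
length-concatMap-≤ f f≤b []       = z≤n
length-concatMap-≤ f f≤b (x ∷ xs) =
  subst (_≤ _) (sym (length-++ (f x))) (+-mono-≤ (f≤b x) (length-concatMap-≤ f f≤b xs))

lookup-injective : ∀ {A : Set} {xs : List A} → Unique xs → Injective _≡_ _≡_ (lookup xs)
lookup-injective (_  ∷ _)     {Fin.zero}  {Fin.zero}  _ = refl
lookup-injective (x≢ ∷ _)     {Fin.zero}  {Fin.suc j} e = contradiction e (All.lookup x≢ (∈-lookup j))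
lookup-injective (x≢ ∷ _)     {Fin.suc i} {Fin.zero}  e = contradiction (sym e) (All.lookup x≢ (∈-lookup i))
lookup-injective (_  ∷ uniq)  {Fin.suc i} {Fin.suc j} e = cong Fin.suc (lookup-injective uniq e)

sum-map-≤ : ∀ {A : Set} (f : A → ℕ) {b} → (∀ x → f x ≤ b) → ∀ xs → sum (List.map f xs) ≤ length xs * b
sum-map-≤ f f≤b []       = z≤n
sum-map-≤ f f≤b (x ∷ xs) = +-mono-≤ (f≤b x) (sum-map-≤ f f≤b xs)

edgeCount≤ : ∀ {m} (E : SEdges m) → edgeCount E ≤ m * m
edgeCount≤ {m} E = subst (λ l → edgeCount E ≤ l * l) (length-tabulate {n = m} (λ v → v)) bound
  where
  indicator≤1 : ∀ a b → (if a then (if b then 1 else 0) else 0) ≤ 1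
  indicator≤1 false _     = z≤n
  indicator≤1 true  false = z≤n
  indicator≤1 true  true  = ≤-refl
  l : ℕ
  l = length (allFin m)
  bound : edgeCount E ≤ l * l
  bound = sum-map-≤ _ (λ u → ≤-trans (sum-map-≤ _ (λ v → indicator≤1 (toℕ u <ᵇ toℕ v) (is-just (E u v)))
                                                   (allFin m))
                                     (≤-reflexive (*-identityʳ l)))
                    (allFin m)

-- One occupant for each candidate class 0, …, k/2, and for each pair of them the two ends of an
-- edge of each sign.
witnessBound : ℕ → ℕ
witnessBound k = suc (k / 2) * (1 + suc (k / 2) * 4)

extendAlong : ∀ {m n} {A : Set} → (Fin m → Fin n) → (Fin m → A) → A → Fin n → A
extendAlong ι g d v with any? (λ u → ι u ≟ v)
... | yes (u , _) = g u
... | no _        = d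

extendAlong-∘ : ∀ {m n} {A : Set} {ι : Fin m → Fin n} (g : Fin m → A) d → Injective _≡_ _≡_ ι →
                ∀ u → extendAlong ι g d (ι u) ≡ g u
extendAlong-∘ {ι = ι} g d ι-inj u with any? (λ u′ → ι u′ ≟ ι u)
... | yes (u′ , e) = cong g (ι-inj e)
... | no ∄u        = contradiction (u , refl) ∄u

module _ {n : ℕ} (E : SEdges n) where

  Occupied : (Fin n → Set) → (Fin n → ℕ) → ℕ → Set
  Occupied D c i = ∃[ v ] (D v × c v ≡ i)

  Realised : (Fin n → Set) → (Fin n → ℕ) → (Fin n → Bool) → ℕ → ℕ → Sign → Set
  Realised D c S i j s = ∃[ u ] ∃[ v ] (D u × D v × c u ≡ i × c v ≡ j × switch S E u v ≡ just s)

  OnlyNegativeLoops : (Fin n → Set) → (Fin n → Set) → (Fin n → ℕ) → (Fin n → Bool) → Set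
  OnlyNegativeLoops D₁ D₂ c S =
    ∀ {u v s} → D₁ u → D₂ v → c u ≡ c v → switch S E u v ≡ just s → s ≡ neg × c u ≢ 0

  -- A complete k-colouring of the subgraph induced on D, with every vertex of a negative
  -- colour -i already switched and recoloured +i: c v is the class of v in K_k^*, and S
  -- collects both these switchings and those producing the equivalent signed graph.
  record CompleteOn (k : ℕ) (D : Fin n → Set) (c : Fin n → ℕ) (S : Fin n → Bool) : Set where
    field
      valid   : ∀ {v} → D v → InV k (c v)
      onto    : ∀ i → InV k i → Occupied D c i
      between : ∀ i j → InV k i → InV k j → i ≢ j → ∀ s → Realised D c S i j s
      negLoop : ∀ i → InV k i → i ≢ 0 → Realised D c S i i neg
      noOther : OnlyNegativeLoops D D c S

  CompleteOn≥ : ℕ → (Fin n → Set) → Set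
  CompleteOn≥ k D = ∃[ k′ ] (k ≤ k′ × ∃[ c ] ∃[ S ] CompleteOn k′ D c S)

  module _ {D D′ : Fin n → Set} {c c′ : Fin n → ℕ} {S S′ : Fin n → Bool} {P : ℕ → Set}
           (keep : ∀ {v} → D v → P (c v) → D′ v × c′ v ≡ c v × S′ v ≡ S v) where

    occupied-transfer : ∀ {i} → P i → Occupied D c i → Occupied D′ c′ i
    occupied-transfer Pi (v , dv , refl) = let (dv′ , cv , _) = keep dv Pi in v , dv′ , cv

    realised-transfer : ∀ {i j s} → P i → P j → Realised D c S i j s → Realised D′ c′ S′ i j s
    realised-transfer Pi Pj (u , v , du , dv , refl , refl , t) =
      let (du′ , cu , Su) = keep du Pi
          (dv′ , cv , Sv) = keep dv Pj
      in u , v , du′ , dv′ , cu , cv , trans (switch-cong E Su Sv) t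

  CompleteOn-resp : ∀ {k D D′ c c′ S S′} → (∀ {v} → D v → D′ v) → (∀ {v} → D′ v → D v) →
                    (∀ {v} → D v → c′ v ≡ c v) → (∀ {v} → D v → S′ v ≡ S v) →
                    CompleteOn k D c S → CompleteOn k D′ c′ S′
  CompleteOn-resp {k} {D} {D′} {c} {c′} {S} {S′} D⊆D′ D′⊆D c′≡c S′≡S P = record
    { valid   = λ d′ → subst (InV k) (sym (c′≡c (D′⊆D d′))) (valid (D′⊆D d′))
    ; onto    = λ i Ii → occupied-transfer keep _ (onto i Ii)
    ; between = λ i j Ii Ij i≢j s → realised-transfer keep _ _ (between i j Ii Ij i≢j s)
    ; negLoop = λ i Ii i≢0 → realised-transfer keep _ _ (negLoop i Ii i≢0)
    ; noOther = λ du′ dv′ e t →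
        let du = D′⊆D du′ ; dv = D′⊆D dv′
            (s≡neg , cu≢0) = noOther du dv (trans (sym (c′≡c du)) (trans e (c′≡c dv)))
                                       (trans (sym (switch-cong E (S′≡S du) (S′≡S dv))) t)
        in s≡neg , λ c′u≡0 → cu≢0 (trans (sym (c′≡c du)) c′u≡0)
    }
    where
    open CompleteOn P
    keep : ∀ {v} → D v → ⊤ → D′ v × c′ v ≡ c v × S′ v ≡ S v
    keep d _ = D⊆D′ d , c′≡c d , S′≡S d

  Insert : Fin n → (Fin n → Set) → Fin n → Set
  Insert x D v = v ≡ x ⊎ D v

  realised-sym : (∀ u v → E u v ≡ E v u) → ∀ {D c S i j s} → Realised D c S i j s → Realised D c S j i s
  realised-sym E-sym {S = S} (u , v , du , dv , cu , cv , t) =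
    v , u , dv , du , cv , cu , trans (switch-sym E E-sym S v u) t

  module Insertion (E-sym : ∀ u v → E u v ≡ E v u) (E-loopless : ∀ u → E u u ≡ nothing)
                   {k : ℕ} {D : Fin n → Set} {c : Fin n → ℕ} {S : Fin n → Bool}
                   (P : CompleteOn k D c S) {x : Fin n} (x∉D : ¬ D x) where
    open CompleteOn P

    Sees : ℕ → Sign → Set
    Sees i s = ∃[ u ] (D u × c u ≡ i × switch S E x u ≡ just s)

    SeesAll : Set
    SeesAll = ∀ i → InV k i → i ≢ 0 → ∀ s → Sees i s

    recolour : ℕ → Fin n → ℕ
    recolour a = updateAt c x (const a)

    recolour-x : ∀ a → recolour a x ≡ a
    recolour-x a = updateAt-updates x c

    recolour-D : ∀ {a v} → D v → recolour a v ≡ c v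
    recolour-D {v = v} d = updateAt-minimal v x c λ { refl → x∉D d }

    recolour-sameClass : ∀ {a v} → D v → recolour a x ≡ recolour a v → c v ≡ a
    recolour-sameClass {a} d e = trans (sym (recolour-D d)) (trans (sym e) (recolour-x a))

    keep-recolour : ∀ a {v} → D v → ⊤ → Insert x D v × recolour a v ≡ c v × S v ≡ S v
    keep-recolour _ d _ = inj₂ d , recolour-D d , refl

    valid-recolour : ∀ k′ a → InV k′ a → (∀ {v} → D v → InV k′ (c v)) →
                     ∀ {v} → Insert x D v → InV k′ (recolour a v)
    valid-recolour k′ a Ia _      (inj₁ refl) = subst (InV k′) (sym (recolour-x a)) Ia
    valid-recolour k′ _ _  valid′ (inj₂ d)    = subst (InV k′) (sym (recolour-D d)) (valid′ d)

    sees⇒realised : ∀ {c′ : Fin n → ℕ} {S′ : Fin n → Bool} {Pr : ℕ → Set} {a j s} →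
                    (∀ {v} → D v → Pr (c v) → Insert x D v × c′ v ≡ c v × S′ v ≡ S v) →
                    Pr j → c′ x ≡ a → S′ x ≡ S x → Sees j s → Realised (Insert x D) c′ S′ a j s
    sees⇒realised keep Pj cx Sx (u , du , refl , t) =
      let (_ , cu , Su) = keep du Pj in x , u , inj₁ refl , inj₂ du , cx , cu , trans (switch-cong E Sx Su) t

    noOther-insert : ∀ {c′ : Fin n → ℕ} {S′ : Fin n → Bool} →
      OnlyNegativeLoops (_≡ x) D c′ S′ → OnlyNegativeLoops D D c′ S′ →
      OnlyNegativeLoops (Insert x D) (Insert x D) c′ S′
    noOther-insert {S′ = S′} _ _ (inj₁ refl) (inj₁ refl) _ t =
      contradiction (trans (sym (switch-loopless E E-loopless S′ x)) t) λ ()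
    noOther-insert new _ (inj₁ refl) (inj₂ dv) e t = new refl dv e t
    noOther-insert {S′ = S′} new _ (inj₂ du) (inj₁ refl) e t =
      let (s≡neg , cx≢0) = new refl du (sym e) (trans (switch-sym E E-sym S′ x _) t)
      in s≡neg , λ cu≡0 → cx≢0 (trans (sym e) cu≡0)
    noOther-insert _ old (inj₂ du) (inj₂ dv) e t = old du dv e t

    noOther-recolour : ∀ a → OnlyNegativeLoops D D (recolour a) S
    noOther-recolour _ du dv e t =
      let (s≡neg , cu≢0) = noOther du dv (trans (sym (recolour-D du)) (trans e (recolour-D dv))) t
      in s≡neg , λ z → cu≢0 (trans (sym (recolour-D du)) z)

    joinClass : ∀ a → InV k a → (∀ {v s} → D v → c v ≡ a → switch S E x v ≡ just s → s ≡ neg × a ≢ 0) →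
                CompleteOn k (Insert x D) (recolour a) S
    joinClass a Ia new = record
      { valid   = valid-recolour k a Ia valid
      ; onto    = λ j Ij → occupied-transfer (keep-recolour a) tt (onto j Ij)
      ; between = λ j j′ Ij Ij′ j≢j′ s →
          realised-transfer (keep-recolour a) tt tt (between j j′ Ij Ij′ j≢j′ s)
      ; negLoop = λ j Ij j≢0 → realised-transfer (keep-recolour a) tt tt (negLoop j Ij j≢0)
      ; noOther = noOther-insert {recolour a} {S} new′ (noOther-recolour a)
      }
      where
      new′ : OnlyNegativeLoops (_≡ x) D (recolour a) S
      new′ refl dv e t = let (s≡neg , a≢0) = new dv (recolour-sameClass dv e) t
                    in s≡neg , subst (_≢ 0) (sym (recolour-x a)) a≢0

    joinNonzeroClass : ∀ {i} → InV k i → i ≢ 0 → ¬ Sees i pos → CompleteOn k (Insert x D) (recolour i) S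
    joinNonzeroClass {i} Ii i≢0 ¬pos = joinClass i Ii new
      where
      new : ∀ {v s} → D v → c v ≡ i → switch S E x v ≡ just s → s ≡ neg × i ≢ 0
      new {v} {pos} dv cv t = contradiction (v , dv , cv , t) ¬pos
      new {v} {neg} _  _  _ = refl , i≢0

    joinZeroClass : k % 2 ≡ 1 → (∀ {u} → D u → c u ≡ 0 → switch S E x u ≡ nothing) →
                    CompleteOn k (Insert x D) (recolour 0) S
    joinZeroClass k%2≡1 noEdge = joinClass 0 (InV-zero {k} k%2≡1) λ dv cv t →
      contradiction (trans (sym (noEdge dv cv)) t) λ ()

    newZeroClass : k % 2 ≡ 0 → suc k % 2 ≡ 1 → suc k / 2 ≡ k / 2 → SeesAll →
                   CompleteOn (suc k) (Insert x D) (recolour 0) S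
    newZeroClass k%2≡0 sk%2≡1 half seesAll = record
      { valid   = valid-recolour (suc k) 0 (InV-zero {suc k} sk%2≡1)
                    λ d → InV-nonzero {k} {suc k} (sym half) (valid d) (old≢0 d)
      ; onto    = onto′
      ; between = between′
      ; negLoop = λ i Ii i≢0 → realised-transfer (keep-recolour 0) tt tt (negLoop i (down Ii i≢0) i≢0)
      ; noOther = noOther-insert {recolour 0} {S} new (noOther-recolour 0)
      }
      where
      old≢0 : ∀ {v} → D v → c v ≢ 0
      old≢0 d = InV-even⇒≢0 {k} k%2≡0 (valid d)

      down : ∀ {i} → InV (suc k) i → i ≢ 0 → InV k i
      down = InV-nonzero {suc k} {k} half

      onto′ : ∀ i → InV (suc k) i → Occupied (Insert x D) (recolour 0) i
      onto′ i Ii with i ℕ.≟ 0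
      ... | yes refl = x , inj₁ refl , recolour-x 0
      ... | no i≢0   = occupied-transfer (keep-recolour 0) tt (onto i (down Ii i≢0))

      fromX : ∀ {j} → InV (suc k) j → j ≢ 0 → ∀ s → Realised (Insert x D) (recolour 0) S 0 j s
      fromX {j} Ij j≢0 s =
        sees⇒realised (keep-recolour 0) tt (recolour-x 0) refl (seesAll j (down Ij j≢0) j≢0 s)

      between′ : ∀ i j → InV (suc k) i → InV (suc k) j → i ≢ j → ∀ s →
                 Realised (Insert x D) (recolour 0) S i j s
      between′ i j Ii Ij i≢j s with i ℕ.≟ 0 | j ℕ.≟ 0
      ... | yes refl | yes refl = contradiction refl i≢j
      ... | yes refl | no j≢0   = fromX Ij j≢0 s
      ... | no i≢0   | yes refl = realised-sym E-sym {S = S} (fromX Ii i≢0 s)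
      ... | no i≢0   | no j≢0   =
        realised-transfer (keep-recolour 0) tt tt (between i j (down Ii i≢0) (down Ij j≢0) i≢j s)

      new : OnlyNegativeLoops (_≡ x) D (recolour 0) S
      new refl dv e _ = contradiction (recolour-sameClass dv e) (old≢0 dv)

    module MergeWithZeroClass (k%2≡1 : k % 2 ≡ 1) (sk%2≡0 : suc k % 2 ≡ 0) (half : suc k / 2 ≡ suc (k / 2))
                              (seesAll : SeesAll) (u₀ : ∃[ u ] (D u × c u ≡ 0 × switch S E x u ≢ nothing)) where
      open OddStep {k} half

      top : ℕ
      top = suc (k / 2)

      c′ : Fin n → ℕ
      c′ = updateAt (relabelZero top ∘ c) x (const top)

      -- Makes every edge between x and the class ±0 negative.
      F : Fin n → Bool
      F v = isPos (switch S E x v) ∧ does (c v ℕ.≟ 0)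

      S′ : Fin n → Bool
      S′ v = S v xor F v

      c′-x : c′ x ≡ top
      c′-x = updateAt-updates x (relabelZero top ∘ c)

      c′-D : ∀ {v} → D v → c′ v ≡ relabelZero top (c v)
      c′-D {v} d = updateAt-minimal v x (relabelZero top ∘ c) λ { refl → x∉D d }

      c′≢0 : ∀ {v} → Insert x D v → c′ v ≢ 0
      c′≢0 (inj₁ refl) = subst (_≢ 0) (sym c′-x) λ ()
      c′≢0 (inj₂ d)    = subst (_≢ 0) (sym (c′-D d)) (relabelZero≢0 (k / 2) _)

      F-x : F x ≡ false
      F-x rewrite switch-loopless E E-loopless S x = refl

      S′-x : S′ x ≡ S x
      S′-x = trans (cong (S x xor_) F-x) (xor-identityʳ (S x))

      S′-nonzero : ∀ {v} → c v ≢ 0 → S′ v ≡ S v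
      S′-nonzero {v} cv≢0 =
        trans (cong (λ b → S v xor (isPos (switch S E x v) ∧ b)) (dec-false (c v ℕ.≟ 0) cv≢0))
              (trans (cong (S v xor_) (∧-zeroʳ _)) (xor-identityʳ (S v)))

      switch-x-zero : ∀ {v} → c v ≡ 0 →
                      switch S′ E x v ≡ Maybe.map (flipIf (isPos (switch S E x v))) (switch S E x v)
      switch-x-zero {v} cv≡0 = trans (sym (switch-switch E S F x v))
        (cong (λ b → Maybe.map (flipIf b) (switch S E x v))
              (cong₂ _xor_ F-x (trans (cong (λ b → isPos (switch S E x v) ∧ b) (dec-true (c v ℕ.≟ 0) cv≡0))
                                      (∧-identityʳ _))))

      keep : ∀ {v} → D v → c v ≢ 0 → Insert x D v × c′ v ≡ c v × S′ v ≡ S v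
      keep d cv≢0 = inj₂ d , trans (c′-D d) (relabelZero-nonzero top _ cv≢0) , S′-nonzero cv≢0

      down : ∀ {i} → InV (suc k) i → i ≢ top → InV k i
      down = InV-below-top sk%2≡0

      nonzero : ∀ {i} → InV (suc k) i → i ≢ 0
      nonzero = InV-even⇒≢0 {suc k} sk%2≡0

      valid′ : ∀ {v} → Insert x D v → InV (suc k) (c′ v)
      valid′ (inj₁ refl) = subst (InV (suc k)) (sym c′-x) InV-top
      valid′ (inj₂ d)    = subst (InV (suc k)) (sym (c′-D d)) (InV-relabelZero (valid d))

      onto′ : ∀ i → InV (suc k) i → Occupied (Insert x D) c′ i
      onto′ i Ii with i ℕ.≟ top
      ... | yes refl  = x , inj₁ refl , c′-x
      ... | no i≢top = occupied-transfer keep (nonzero Ii) (onto i (down Ii i≢top))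

      fromX : ∀ {j} → InV (suc k) j → j ≢ top → ∀ s → Realised (Insert x D) c′ S′ top j s
      fromX {j} Ij j≢top s =
        sees⇒realised keep (nonzero Ij) c′-x S′-x (seesAll j (down Ij j≢top) (nonzero Ij) s)

      between′ : ∀ i j → InV (suc k) i → InV (suc k) j → i ≢ j → ∀ s → Realised (Insert x D) c′ S′ i j s
      between′ i j Ii Ij i≢j s with i ℕ.≟ top | j ℕ.≟ top
      ... | yes refl  | yes refl  = contradiction refl i≢j
      ... | yes refl  | no j≢top = fromX Ij j≢top s
      ... | no i≢top | yes refl  = realised-sym E-sym {S = S′} (fromX Ii i≢top s)
      ... | no i≢top | no j≢top =
        realised-transfer keep (nonzero Ii) (nonzero Ij) (between i j (down Ii i≢top) (down Ij j≢top) i≢j s)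

      -- The negative loop of the merged class is the edge from x to u₀.
      negLoop′ : ∀ i → InV (suc k) i → i ≢ 0 → Realised (Insert x D) c′ S′ i i neg
      negLoop′ i Ii i≢0 with i ℕ.≟ top
      ... | yes refl  = let (u , du , cu≡0 , t) = u₀ in
        x , u , inj₁ refl , inj₂ du , c′-x , trans (c′-D du) (cong (relabelZero top) cu≡0) ,
        trans (switch-x-zero cu≡0) (flipIf-isPos-≢nothing _ t)
      ... | no i≢top = realised-transfer keep i≢0 i≢0 (negLoop i (down Ii i≢top) i≢0)

      new : OnlyNegativeLoops (_≡ x) D c′ S′
      new {v = v} refl dv e t =
        flipIf-isPos-≡just (switch S E x v) (trans (sym (switch-x-zero cv≡0)) t) , c′≢0 (inj₁ refl)
        where
        cv≡0 : c v ≡ 0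
        cv≡0 = relabelZero-injective (valid dv) (InV-zero {k} k%2≡1)
                                     (trans (sym (c′-D dv)) (trans (sym e) c′-x))

      old : OnlyNegativeLoops D D c′ S′
      old {u} {v} {s} du dv e t = s≡neg , c′≢0 (inj₂ du)
        where
        cu≡cv : c u ≡ c v
        cu≡cv = relabelZero-injective (valid du) (valid dv) (trans (sym (c′-D du)) (trans e (c′-D dv)))
        s≡neg : s ≡ neg
        s≡neg with c u ℕ.≟ 0
        ... | yes cu≡0 =
          let (_ , t₀) = map-≡just (switch S E u v) (trans (switch-switch E S F u v) t)
          in contradiction cu≡0 (proj₂ (noOther du dv cu≡cv t₀))
        ... | no cu≢0 =
          let cv≢0 = λ cv≡0 → cu≢0 (trans cu≡cv cv≡0)
          in proj₁ (noOther du dv cu≡cv (trans (sym (switch-cong E (S′-nonzero cu≢0) (S′-nonzero cv≢0))) t))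

      mergeWithZeroClass : CompleteOn (suc k) (Insert x D) c′ S′
      mergeWithZeroClass = record
        { valid = valid′ ; onto = onto′ ; between = between′ ; negLoop = negLoop′
        ; noOther = noOther-insert {c′} {S′} new old }

    sees? : (∀ v → Dec (D v)) → ∀ i s → Dec (Sees i s)
    sees? D? i s = any? λ u → D? u ×-dec (c u ℕ.≟ i ×-dec (switch S E x u ≟ᵐ just s))

    seesAll-or-missing : (∀ v → Dec (D v)) → ∀ s →
                         (∀ i → InV k i → i ≢ 0 → Sees i s) ⊎ ∃[ i ] (InV k i × i ≢ 0 × ¬ Sees i s)
    seesAll-or-missing D? s with anyUpTo? (λ i → ¬? (i ℕ.≟ 0) ×-dec ¬? (sees? D? i s)) (suc (k / 2))
    ... | yes (i , i< , i≢0 , ¬sees) = inj₂ (i , InV-intro {k} (≤-pred i<) i≢0 , i≢0 , ¬sees)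
    ... | no none = inj₁ λ i Ii i≢0 →
      decidable-stable (sees? D? i s) λ ¬sees → none (i , InV⇒< {k} Ii , i≢0 , ¬sees)

    seesBoth : (∀ i → InV k i → i ≢ 0 → Sees i pos) → (∀ i → InV k i → i ≢ 0 → Sees i neg) → SeesAll
    seesBoth allPos _      i Ii i≢0 pos = allPos i Ii i≢0
    seesBoth _      allNeg i Ii i≢0 neg = allNeg i Ii i≢0

  module InsertionStep (E-sym : ∀ u v → E u v ≡ E v u) (E-loopless : ∀ u → E u u ≡ nothing)
                       {k : ℕ} {D : Fin n → Set} {c : Fin n → ℕ} {S : Fin n → Bool}
                       (D? : ∀ v → Dec (D v)) (P : CompleteOn k D c S) {x : Fin n} (x∉D : ¬ D x) where
    open Insertion E-sym E-loopless P x∉D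

    Sˣ : Fin n → Bool
    Sˣ w = S w xor does (w ≟ x)

    switch-Sˣ : ∀ {u} → u ≢ x → switch Sˣ E x u ≡ Maybe.map flip (switch S E x u)
    switch-Sˣ {u} u≢x = trans (sym (switch-switch E S (λ w → does (w ≟ x)) x u))
      (cong (λ b → Maybe.map (flipIf b) (switch S E x u))
            (cong₂ _xor_ (dec-true (x ≟ x) refl) (dec-false (u ≟ x) u≢x)))

    joinNonzeroClassSwitched : ∀ {i} → InV k i → i ≢ 0 → ¬ Sees i neg →
                               CompleteOn k (Insert x D) (recolour i) Sˣ
    joinNonzeroClassSwitched {i} Ii i≢0 ¬neg = Insertion.joinNonzeroClass E-sym E-loopless Pˣ x∉D Ii i≢0 ¬pos
      where
      ∉D⇒≢x : ∀ {v} → D v → v ≢ x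
      ∉D⇒≢x d refl = x∉D d
      Pˣ : CompleteOn k D c Sˣ
      Pˣ = CompleteOn-resp (λ d → d) (λ d → d) (λ _ → refl)
             (λ {v} d → trans (cong (S v xor_) (dec-false (v ≟ x) (∉D⇒≢x d))) (xor-identityʳ (S v))) P
      ¬pos : ¬ Insertion.Sees E-sym E-loopless Pˣ x∉D i pos
      ¬pos (u , du , cu , t) = map-flip-≢ (switch S E x u) pos (λ t′ → ¬neg (u , du , cu , t′))
                                          (trans (sym (switch-Sˣ (∉D⇒≢x du))) t)

    insertNew : CompleteOn≥ k (Insert x D)
    insertNew with seesAll-or-missing D? pos | seesAll-or-missing D? neg
    ... | inj₂ (i , Ii , i≢0 , ¬pos) | _ = k , ≤-refl , _ , _ , joinNonzeroClass Ii i≢0 ¬pos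
    ... | inj₁ _ | inj₂ (i , Ii , i≢0 , ¬neg) = k , ≤-refl , _ , _ , joinNonzeroClassSwitched Ii i≢0 ¬neg
    ... | inj₁ allPos | inj₁ allNeg with parityStep k
    ...   | even k%2≡0 sk%2≡1 half =
      suc k , ℕ.n≤1+n k , _ , _ , newZeroClass k%2≡0 sk%2≡1 half (seesBoth allPos allNeg)
    ...   | odd k%2≡1 sk%2≡0 half
      with any? (λ u → D? u ×-dec (c u ℕ.≟ 0 ×-dec ¬? (switch S E x u ≟ᵐ nothing)))
    ...     | yes u₀ = suc k , ℕ.n≤1+n k , _ , _ ,
                       MergeWithZeroClass.mergeWithZeroClass k%2≡1 sk%2≡0 half (seesBoth allPos allNeg) u₀
    ...     | no ¬u₀ = k , ≤-refl , _ , _ , joinZeroClass k%2≡1 λ {u} du cu≡0 →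
                       decidable-stable (switch S E x u ≟ᵐ nothing) λ t → ¬u₀ (u , du , cu≡0 , t)

  insert : IsSigned E → ∀ {k D c S} → (∀ v → Dec (D v)) → CompleteOn k D c S →
           ∀ x → CompleteOn≥ k (Insert x D)
  insert _ {k} D? P x with D? x
  ... | yes x∈D = k , ≤-refl , _ , _ ,
    CompleteOn-resp inj₂ (λ { (inj₁ refl) → x∈D ; (inj₂ d) → d }) (λ _ → refl) (λ _ → refl) P
  insert (E-sym , E-loopless) D? P x | no x∉D = InsertionStep.insertNew E-sym E-loopless D? P x∉D

  extendOver : IsSigned E → ∀ {k D c S} → (∀ v → Dec (D v)) → CompleteOn k D c S →
               ∀ xs → CompleteOn≥ k (λ v → D v ⊎ v ∈ xs)
  extendOver _ {k} _ P [] =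
    k , ≤-refl , _ , _ , CompleteOn-resp inj₁ (λ { (inj₁ d) → d }) (λ _ → refl) (λ _ → refl) P
  extendOver signed {D = D} D? P (x ∷ xs) with extendOver signed D? P xs
  ... | _ , k≤k′ , _ , _ , P′ with insert signed (λ v → D? v ⊎-dec Any.any? (v ≟_) xs) P′ x
  ...   | k″ , k′≤k″ , _ , _ , P″ = k″ , ≤-trans k≤k′ k′≤k″ , _ , _ ,
    CompleteOn-resp ⊆ ⊇ (λ _ → refl) (λ _ → refl) P″
    where
    ⊆ : ∀ {v} → Insert x (λ w → D w ⊎ w ∈ xs) v → D v ⊎ v ∈ x ∷ xs
    ⊆ (inj₁ refl)      = inj₂ (here refl)
    ⊆ (inj₂ (inj₁ d))  = inj₁ d
    ⊆ (inj₂ (inj₂ v∈)) = inj₂ (there v∈)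
    ⊇ : ∀ {v} → D v ⊎ v ∈ x ∷ xs → Insert x (λ w → D w ⊎ w ∈ xs) v
    ⊇ (inj₁ d)           = inj₂ (inj₁ d)
    ⊇ (inj₂ (here refl)) = inj₁ refl
    ⊇ (inj₂ (there v∈))  = inj₂ (inj₂ v∈)

  extendToAll : IsSigned E → ∀ {k D c S} → (∀ v → Dec (D v)) → CompleteOn k D c S →
                CompleteOn≥ k (λ _ → ⊤)
  extendToAll signed D? P with extendOver signed D? P (allFin n)
  ... | k′ , k≤k′ , _ , _ , P′ = k′ , k≤k′ , _ , _ ,
    CompleteOn-resp (const tt) (λ {v} _ → inj₂ (∈-allFin v)) (λ _ → refl) (λ _ → refl) P′

  Image : ∀ {m} → (Fin m → Fin n) → Fin n → Set
  Image ι v = ∃[ u ] ι u ≡ v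

  completeOn-image⇒achievable : ∀ {m k c S} (ι : Fin m → Fin n) → CompleteOn k (Image ι) c S →
                                Achievable (restrict ι E) k
  completeOn-image⇒achievable {c = c} {S} ι P = S ∘ ι , φ , record
    { valid   = λ u → valid (u , refl) , λ _ → refl
    ; onto    = λ i Ii → occupied (onto i Ii)
    ; between = λ i j Ii Ij i≢j s → realised (between i j Ii Ij i≢j s)
    ; negLoop = λ i Ii i≢0 → realised (negLoop i Ii i≢0)
    ; noOther = λ u v s e t → noOther (u , refl) (v , refl) e (trans (sym (map-flipIf-false _)) t)
    }
    where
    open CompleteOn P
    φ : _ → Colour
    φ u = c (ι u) , false
    occupied : ∀ {i} → Occupied (Image ι) c i → ∃[ u ] idx φ u ≡ i
    occupied (_ , (u , refl) , cu) = u , cu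
    realised : ∀ {i j s} → Realised (Image ι) c S i j s →
               ∃[ u ] ∃[ v ] (idx φ u ≡ i × idx φ v ≡ j ×
                              reduceSwitch φ (switch (S ∘ ι) (restrict ι E)) u v ≡ just s)
    realised (_ , _ , (u , refl) , (v , refl) , cu , cv , t) = u , v , cu , cv , trans (map-flipIf-false _) t

  achievable-restrict⇒completeOn : ∀ {m k} {ι : Fin m → Fin n} → Injective _≡_ _≡_ ι →
                                   Achievable (restrict ι E) k → ∃[ c ] ∃[ S ] CompleteOn k (Image ι) c S
  achievable-restrict⇒completeOn {m} {k} {ι} ι-inj (T , φ , C) = c , S , record
    { valid   = λ { (u , refl) → subst (InV k) (sym (c-ι u)) (proj₁ (valid u)) }
    ; onto    = λ i Ii → let (u , cu) = onto i Ii in ι u , (u , refl) , trans (c-ι u) cu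
    ; between = λ i j Ii Ij i≢j s → realised (between i j Ii Ij i≢j s)
    ; negLoop = λ i Ii i≢0 → realised (negLoop i Ii i≢0)
    ; noOther = noOther′
    }
    where
    open Complete C
    B : Fin m → Bool
    B u = T u xor proj₂ (φ u)
    c : Fin n → ℕ
    c = extendAlong ι (idx φ) 0
    S : Fin n → Bool
    S = extendAlong ι B false
    c-ι : ∀ u → c (ι u) ≡ idx φ u
    c-ι = extendAlong-∘ (idx φ) 0 ι-inj
    switch-ι : ∀ u v → switch S E (ι u) (ι v) ≡ reduceSwitch φ (switch T (restrict ι E)) u v
    switch-ι u v = trans (cong (λ b → Maybe.map (flipIf b) (E (ι u) (ι v)))
                               (cong₂ _xor_ (extendAlong-∘ B false ι-inj u) (extendAlong-∘ B false ι-inj v)))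
                         (sym (switch-switch (restrict ι E) T (proj₂ ∘ φ) u v))
    realised : ∀ {i j s} →
               ∃[ u ] ∃[ v ] (idx φ u ≡ i × idx φ v ≡ j × reduceSwitch φ (switch T (restrict ι E)) u v ≡ just s) →
               Realised (Image ι) c S i j s
    realised (u , v , cu , cv , t) =
      ι u , ι v , (u , refl) , (v , refl) , trans (c-ι u) cu , trans (c-ι v) cv , trans (switch-ι u v) t
    noOther′ : OnlyNegativeLoops (Image ι) (Image ι) c S
    noOther′ {s = s} (u , refl) (v , refl) e t =
      let (s≡neg , cu≢0) = noOther u v s (trans (sym (c-ι u)) (trans e (c-ι v))) (trans (sym (switch-ι u v)) t)
      in s≡neg , λ z → cu≢0 (trans (sym (c-ι u)) z)

  completeOn-all⇒achievable : ∀ {k c S} → CompleteOn k (λ _ → ⊤) c S → Achievable E k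
  completeOn-all⇒achievable P =
    completeOn-image⇒achievable (λ v → v)
      (CompleteOn-resp (λ {v} _ → v , refl) (const tt) (λ _ → refl) (λ _ → refl) P)

  achievable⇒completeOn-all : ∀ {k} → Achievable E k → ∃[ c ] ∃[ S ] CompleteOn k (λ _ → ⊤) c S
  achievable⇒completeOn-all achievable =
    let (c , S , P) = achievable-restrict⇒completeOn {ι = λ v → v} (λ e → e) achievable
    in c , S , CompleteOn-resp (const tt) (λ {v} _ → v , refl) (λ _ → refl) (λ _ → refl) P

  achievable-monotone : IsSigned E → ∀ {m k} {ι : Fin m → Fin n} → Injective _≡_ _≡_ ι →
                        Achievable (restrict ι E) k → ∃[ k′ ] (k ≤ k′ × Achievable E k′)
  achievable-monotone signed {ι = ι} ι-inj achievable =
    let (_ , _ , P) = achievable-restrict⇒completeOn ι-inj achievable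
        (k′ , k≤k′ , _ , _ , P′) = extendToAll signed (λ v → any? (λ u → ι u ≟ v)) P
    in k′ , k≤k′ , completeOn-all⇒achievable P′

  Psi≡-restrict : IsSigned E → ∀ {m k} {ι : Fin m → Fin n} → Injective _≡_ _≡_ ι →
                  Psi≡ E k → Achievable (restrict ι E) k → Psi≡ (restrict ι E) k
  Psi≡-restrict signed ι-inj (1≤k , _ , maximal) achievable =
    1≤k , achievable , λ k′ 1≤k′ achievable′ →
    let (k″ , k′≤k″ , achievable″) = achievable-monotone signed ι-inj achievable′
    in ≤-trans k′≤k″ (maximal k″ (≤-trans 1≤k′ k′≤k″) achievable″)

  module Witnesses {k : ℕ} {c : Fin n → ℕ} {S : Fin n → Bool} (P : CompleteOn k (λ _ → ⊤) c S) where
    open CompleteOn P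

    occupied? : ∀ i → Dec (∃[ v ] c v ≡ i)
    occupied? i = any? λ v → c v ℕ.≟ i

    realised? : ∀ i j s → Dec (∃[ u ] ∃[ v ] (c u ≡ i × c v ≡ j × switch S E u v ≡ just s))
    realised? i j s =
      any? λ u → any? λ v → c u ℕ.≟ i ×-dec (c v ℕ.≟ j ×-dec (switch S E u v ≟ᵐ just s))

    occupant : ℕ → List (Fin n)
    occupant i with occupied? i
    ... | yes (v , _) = v ∷ []
    ... | no _        = []

    ends : ℕ → ℕ → Sign → List (Fin n)
    ends i j s with realised? i j s
    ... | yes (u , v , _) = u ∷ v ∷ []
    ... | no _            = []

    classes : List ℕ
    classes = upTo (suc (k / 2))

    row : ℕ → List (Fin n)
    row i = occupant i ++ concatMap (λ j → ends i j pos ++ ends i j neg) classes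

    witnesses : List (Fin n)
    witnesses = concatMap row classes

    occupant-occupied : ∀ {i} → Occupied (λ _ → ⊤) c i → Occupied (_∈ occupant i) c i
    occupant-occupied {i} (v , _ , cv) with occupied? i
    ... | yes (v′ , cv′) = v′ , here refl , cv′
    ... | no ∄v          = contradiction (v , cv) ∄v

    ends-realised : ∀ {i j s} → Realised (λ _ → ⊤) c S i j s → Realised (_∈ ends i j s) c S i j s
    ends-realised {i} {j} {s} (u , v , _ , _ , cu , cv , t) with realised? i j s
    ... | yes (u′ , v′ , cu′ , cv′ , t′) = u′ , v′ , here refl , there (here refl) , cu′ , cv′ , t′
    ... | no ∄uv                         = contradiction (u , v , cu , cv , t) ∄uv

    ∈-row⇒∈-witnesses : ∀ {i v} → InV k i → v ∈ row i → v ∈ witnesses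
    ∈-row⇒∈-witnesses Ii v∈ = ∈-concatMap⁺ row (lose (∈-upTo⁺ (InV⇒< {k} Ii)) v∈)

    ∈-ends⇒∈-row : ∀ {i j s v} → InV k j → v ∈ ends i j s → v ∈ row i
    ∈-ends⇒∈-row {i} {j} {s} Ij v∈ = ∈-++⁺ʳ (occupant i)
      (∈-concatMap⁺ (λ j → ends i j pos ++ ends i j neg) (lose (∈-upTo⁺ (InV⇒< {k} Ij)) (bothSigns s v∈)))
      where
      bothSigns : ∀ s {v} → v ∈ ends i j s → v ∈ ends i j pos ++ ends i j neg
      bothSigns pos v∈ = ∈-++⁺ˡ v∈
      bothSigns neg v∈ = ∈-++⁺ʳ (ends i j pos) v∈

    witnesses-complete : CompleteOn k (_∈ witnesses) c S
    witnesses-complete = record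
      { valid   = λ _ → valid tt
      ; onto    = λ i Ii → occupied-transfer (keepOccupant Ii) tt (occupant-occupied (onto i Ii))
      ; between = λ i j Ii Ij i≢j s →
          realised-transfer (keepEnds Ii Ij) tt tt (ends-realised (between i j Ii Ij i≢j s))
      ; negLoop = λ i Ii i≢0 → realised-transfer (keepEnds Ii Ii) tt tt (ends-realised (negLoop i Ii i≢0))
      ; noOther = λ _ _ → noOther tt tt
      }
      where
      keepOccupant : ∀ {i v} → InV k i → v ∈ occupant i → ⊤ → v ∈ witnesses × c v ≡ c v × S v ≡ S v
      keepOccupant Ii v∈ _ = ∈-row⇒∈-witnesses Ii (∈-++⁺ˡ v∈) , refl , refl
      keepEnds : ∀ {i j s v} → InV k i → InV k j → v ∈ ends i j s → ⊤ →
                 v ∈ witnesses × c v ≡ c v × S v ≡ S v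
      keepEnds Ii Ij v∈ _ = ∈-row⇒∈-witnesses Ii (∈-ends⇒∈-row Ij v∈) , refl , refl

    length-occupant : ∀ i → length (occupant i) ≤ 1
    length-occupant i with occupied? i
    ... | yes _ = ≤-refl
    ... | no _  = z≤n

    length-ends : ∀ i j s → length (ends i j s) ≤ 2
    length-ends i j s with realised? i j s
    ... | yes _ = ≤-refl
    ... | no _  = z≤n

    length-witnesses : length witnesses ≤ witnessBound k
    length-witnesses = subst (λ N → length witnesses ≤ N * (1 + N * 4)) (length-upTo (suc (k / 2)))
      (length-concatMap-≤ row length-row classes)
      where
      length-ends-pos-neg : ∀ i j → length (ends i j pos ++ ends i j neg) ≤ 4
      length-ends-pos-neg i j = subst (_≤ 4) (sym (length-++ (ends i j pos) {ends i j neg}))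
                                      (+-mono-≤ (length-ends i j pos) (length-ends i j neg))
      length-row : ∀ i → length (row i) ≤ 1 + length classes * 4
      length-row i = subst (_≤ _) (sym (length-++ (occupant i)))
        (+-mono-≤ (length-occupant i)
                  (length-concatMap-≤ (λ j → ends i j pos ++ ends i j neg) (length-ends-pos-neg i) classes))

  SmallInduced : (∀ {m} → SEdges m → Set) → ℕ → Set
  SmallInduced Q k =
    ∃[ m ] Σ[ ι ∈ (Fin m → Fin n) ] (Injective _≡_ _≡_ ι × Q (restrict ι E) × m ≤ witnessBound k)

  completeOn-all⇒small : ∀ {k c S} → CompleteOn k (λ _ → ⊤) c S → SmallInduced (λ H → Achievable H k) k
  completeOn-all⇒small P =
    length L , lookup L , lookup-injective (deduplicate-! _≟_ witnesses) ,
    completeOn-image⇒achievable (lookup L)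
      (CompleteOn-resp ∈⇒image image⇒∈ (λ _ → refl) (λ _ → refl) witnesses-complete) ,
    ≤-trans (length-deduplicate _≟_ witnesses) length-witnesses
    where
    open Witnesses P
    L : List (Fin n)
    L = deduplicate _≟_ witnesses
    ∈⇒image : ∀ {v} → v ∈ witnesses → Image (lookup L) v
    ∈⇒image v∈ = let v∈L = ∈-deduplicate⁺ _≟_ v∈ in Any.index v∈L , sym (lookup-index v∈L)
    image⇒∈ : ∀ {v} → Image (lookup L) v → v ∈ witnesses
    image⇒∈ (i , refl) = ∈-deduplicate⁻ _≟_ witnesses (∈-lookup i)

  Psi≡⇒smallInduced : IsSigned E → ∀ {k} → Psi≡ E k → SmallInduced (λ H → Psi≡ H k) k
  Psi≡⇒smallInduced signed {k} ψ≡k@(_ , achievable , _) =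
    psi (completeOn-all⇒small (proj₂ (proj₂ (achievable⇒completeOn-all achievable))))
    where
    psi : SmallInduced (λ H → Achievable H k) k → SmallInduced (λ H → Psi≡ H k) k
    psi (m , ι , ι-inj , achievable′ , m≤) = m , ι , ι-inj , Psi≡-restrict signed ι-inj ψ≡k achievable′ , m≤

-- ((k+1)(4k+5))², the square of the bound on the number of witnesses
fpoly : Poly
fpoly = 25 ∷ 90 ∷ 121 ∷ 72 ∷ 16 ∷ []

eval-fpoly : ∀ k → (suc k * (1 + suc k * 4)) * (suc k * (1 + suc k * 4)) ≡ eval fpoly k
eval-fpoly = solve 1 (λ k → let w = (con 1 :+ k) :* (con 1 :+ (con 1 :+ k) :* con 4) in
                            w :* w := con 25 :+ k :* (con 90 :+ k :* (con 121 :+ k :*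
                                                     (con 72 :+ k :* (con 16 :+ k :* con 0)))))
                     refl
  where open +-*-Solver

witnessBound-≤ : ∀ k → witnessBound k ≤ suc k * (1 + suc k * 4)
witnessBound-≤ k = *-mono-≤ half≤ (+-mono-≤ (≤-refl {1}) (*-mono-≤ half≤ ≤-refl))
  where
  half≤ : suc (k / 2) ≤ suc k
  half≤ = s≤s (m/n≤m k 2)

theorem4p1 : ∃[ f ] (∀ (k : ℕ) → 1 ≤ k → ∀ (n : ℕ) (σ : SEdges n) → IsSigned σ → Psi≡ σ k →
               ∃[ m ] ∃[ ι ] (Injective {A = Fin m} {B = Fin n} _≡_ _≡_ ι
                 × Psi≡ (restrict ι σ) k × edgeCount (restrict ι σ) ≤ eval f k))
theorem4p1 = fpoly , λ k _ n σ signed ψ≡k → fewEdges k σ (Psi≡⇒smallInduced σ signed ψ≡k)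
  where
  fewEdges : ∀ k {n} (σ : SEdges n) → SmallInduced σ (λ H → Psi≡ H k) k →
    ∃[ m ] ∃[ ι ] (Injective {A = Fin m} {B = Fin n} _≡_ _≡_ ι
      × Psi≡ (restrict ι σ) k × edgeCount (restrict ι σ) ≤ eval fpoly k)
  fewEdges k σ (m , ι , ι-inj , ψ′≡k , m≤) =
    m , ι , ι-inj , ψ′≡k ,
    ≤-trans (edgeCount≤ (restrict ι σ)) (≤-trans (*-mono-≤ m≤′ m≤′) (≤-reflexive (eval-fpoly k)))
    where
    m≤′ : m ≤ suc k * (1 + suc k * 4)
    m≤′ = ≤-trans m≤ (witnessBound-≤ k)
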